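{- Let $m = p_1^{e_1}\cdots p_r^{e_r}$, $R = \{1,\ldots,r\}$, and let $I \subseteq R$. Let $C_I$ be the connected component of the sequential power graph of $\mathbb{Z}/m\mathbb{Z}$ containing the idempotent $d_I$. Then $C_I$ contains the multiplier $\pi_I$ and contains no other multiplier $\pi_J$ with $J \subseteq R$, $J \neq I$.
   Context: $m = p_1^{e_1}\cdots p_r^{e_r}$ with distinct primes $p_i$ and $e_i \ge 1$. For $I \subseteq R$: $\pi_I = \prod_{i \in I} p_i$ (the multiplier of $I$, with $\pi_\emptyset = 1$), considered modulo $m$; $g_I = \prod_{i\in I} p_i^{e_i}$; and $d_I$ is the idempotent of $\mathbb{Z}/m\mathbb{Z}$ with $d_I \equiv 0 \pmod{p_i^{e_i}}$ for $i \in I$ and $d_I \equiv 1 \pmod{p_j^{e_j}}$ for $j \notin I$ (equivalently $d_I = a_I g_I$ with $a_I \equiv g_I^{ -1} \pmod{m/g_I}$). The sequential power graph of $\mathbb{Z}/m\mathbb{Z}$ is the directed graph with vertex set $\mathbb{Z}/m\mathbb{Z}$ and an edge $(b,c)$ iff $b \equiv a^i$, $c \equiv a^{i+1} \pmod m$ for some $a$ and $i \in \mathbb{N}$; connected components are taken with respect to undirected paths. -}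

module Defs where

open import Data.Nat using (ℕ; zero; suc; _*_; _^_; _≤_; ∣_-_∣)
open import Data.Nat.Divisibility using (_∣_)
open import Data.Fin using (Fin; toℕ)
import Data.Fin as F
open import Data.Fin.Subset using (Subset; _∈_; _∉_)
open import Data.Vec using (_∷_; [])
open import Data.Bool using (true; false)
open import Data.Product using (Σ; ∃; _×_)
open import Relation.Binary.Construct.Closure.Equivalence using (EqClosure)

_≡_[mod_] : ℕ → ℕ → ℕ → Set
x ≡ y [mod m ] = m ∣ ∣ x - y ∣

∏ : ∀ {r} → (Fin r → ℕ) → ℕ
∏ {zero} f = 1
∏ {suc r} f = f F.zero * ∏ (λ i → f (F.suc i))

∏∈ : ∀ {r} → Subset r → (Fin r → ℕ) → ℕ
∏∈ [] f = 1
∏∈ (true ∷ I) f = f F.zero * ∏∈ I (λ i → f (F.suc i))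
∏∈ (false ∷ I) f = ∏∈ I (λ i → f (F.suc i))

modulus : ∀ {r} → (Fin r → ℕ) → (Fin r → ℕ) → ℕ
modulus p e = ∏ (λ i → p i ^ e i)

-- multiplier π_I = ∏_{i ∈ I} p_i  (as a natural number; taken mod m below)
multiplier : ∀ {r} → (Fin r → ℕ) → Subset r → ℕ
multiplier p I = ∏∈ I p

-- d is (a representative of) the idempotent d_I of ℤ/mℤ:
-- d ≡ 0 mod p_i^{e_i} for i ∈ I, d ≡ 1 mod p_j^{e_j} for j ∉ I
IsIdempotentFor : ∀ {r} → (Fin r → ℕ) → (Fin r → ℕ) → Subset r → ℕ → Set
IsIdempotentFor p e I d =
  (∀ i → i ∈ I → d ≡ 0 [mod p i ^ e i ]) ×
  (∀ j → j ∉ I → d ≡ 1 [mod p j ^ e j ])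

-- Sequential power graph of ℤ/mℤ (vertices: residues Fin m):
-- edge (b,c) iff b ≡ a^i, c ≡ a^{i+1} (mod m) for some a and some i ∈ ℕ = {1,2,...}
SPEdge : (m : ℕ) → Fin m → Fin m → Set
SPEdge m b c = ∃ λ (a : ℕ) → ∃ λ (i : ℕ) →
  (1 ≤ i) × (toℕ b ≡ a ^ i [mod m ]) × (toℕ c ≡ a ^ suc i [mod m ])

SameComponent : (m : ℕ) → Fin m → Fin m → Set
SameComponent m = EqClosure (SPEdge m)

module Submission where

open import Defs
open import Data.Nat
  using (ℕ; zero; suc; _+_; _*_; _∸_; _^_; _/_; _%_; _≤_; _<_; z≤n; s≤s; NonZero; ∣_-_∣; nonTrivial⇒n>1; >-nonZero; >-nonZero⁻¹)
open import Data.Nat.Properties hiding (suc-injective)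
open import Data.Nat.DivMod using (_mod_; m≡m%n+[m/n]*n; %-remove-+ʳ; %-distribˡ-*; m%n%n≡m%n; m<n⇒m%n≡m)
open import Data.Nat.Divisibility
open import Data.Nat.Primality using (Prime; euclidsLemma; prime⇒irreducible; prime⇒nonZero; prime⇒nonTrivial)
open import Data.Fin using (Fin; toℕ)
import Data.Fin as Fin
open import Data.Fin.Properties using (toℕ-fromℕ<; toℕ-injective; toℕ<n; pigeonhole; suc-injective)
open import Data.Fin.Subset using (Subset; _∈_)
open import Data.Fin.Subset.Properties using (_∈?_; ⊆-antisym)
open import Data.Vec.Base using (_∷_; []; here; there)
open import Data.Bool using (true; false)
open import Data.Product using (∃; ∃₂; _×_; _,_; proj₁; proj₂)
open import Data.Sum using (inj₁; inj₂)
open import Data.Empty using (⊥-elim)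
open import Function.Base using (_∘_)
open import Function.Bundles using (_⇔_; mk⇔; Equivalence)
open import Function.Properties.Equivalence using (⇔-isEquivalence) renaming (sym to ⇔-sym; trans to ⇔-trans)
open import Function.Definitions using (Injective)
open import Relation.Binary.PropositionalEquality
  using (_≡_; _≢_; refl; sym; trans; cong; cong₂; subst; module ≡-Reasoning)
open import Relation.Binary.Construct.Closure.ReflexiveTransitive using (ε; _◅◅_)
open import Relation.Binary.Construct.Closure.Equivalence using (return; gfold; symmetric)
open import Relation.Nullary using (¬_; yes; no)

-- For a prime q ∣ m, the endpoints a^i and a^(i+1) (i ≥ 1) of an edge are divisible by q
-- exactly when a is, so the set of p_j dividing a vertex is constant on a component. It is I
-- at d_I and J at π_J, hence π_J ∉ C_I when J ≠ I.
-- Conversely π_I, π_I², … is a path, and by the pigeonhole principle some power π_I^N with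
-- N ≥ m is idempotent mod m. Modulo p_j^(e_j) it vanishes for j ∈ I (as N ≥ e_j), and for
-- j ∉ I it is an idempotent unit, hence 1; by the Chinese remainder theorem π_I^N ≡ d_I.

prime>1 : ∀ {q} → Prime q → 1 < q
prime>1 {q} q-prime = nonTrivial⇒n>1 q {{prime⇒nonTrivial q-prime}}

prime∤1 : ∀ {q} → Prime q → ¬ q ∣ 1
prime∤1 q-prime q∣1 = <-irrefl (sym (∣1⇒≡1 q∣1)) (prime>1 q-prime)

prime∣prime⇒≡ : ∀ {q p} → Prime q → Prime p → q ∣ p → q ≡ p
prime∣prime⇒≡ q-prime p-prime q∣p with prime⇒irreducible p-prime q∣p
... | inj₁ refl = ⊥-elim (prime∤1 q-prime ∣-refl)
... | inj₂ q≡p = q≡p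

prime∣^⇒∣ : ∀ {q a} n → Prime q → q ∣ a ^ n → q ∣ a
prime∣^⇒∣ zero q-prime q∣1 = ⊥-elim (prime∤1 q-prime q∣1)
prime∣^⇒∣ {a = a} (suc n) q-prime q∣a^1+n with euclidsLemma a (a ^ n) q-prime q∣a^1+n
... | inj₁ q∣a = q∣a
... | inj₂ q∣a^n = prime∣^⇒∣ n q-prime q∣a^n

prime∣^suc⇔∣ : ∀ {q a} n → Prime q → q ∣ a ^ suc n ⇔ q ∣ a
prime∣^suc⇔∣ {a = a} n q-prime = mk⇔ (prime∣^⇒∣ (suc n) q-prime) (∣m⇒∣m*n (a ^ n))

∣⇒^∣^ : ∀ {q a} n → q ∣ a → q ^ n ∣ a ^ n
∣⇒^∣^ zero    _   = ∣-refl
∣⇒^∣^ (suc n) q∣a = *-pres-∣ q∣a (∣⇒^∣^ n q∣a)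

∣∧≤⇒^∣^ : ∀ {q a e n} → q ∣ a → e ≤ n → q ^ e ∣ a ^ n
∣∧≤⇒^∣^ {q} {a} {e} {n} q∣a e≤n = subst (q ^ e ∣_) a^e*a^[n∸e]≡a^n (∣m⇒∣m*n (a ^ (n ∸ e)) (∣⇒^∣^ e q∣a))
  where
  a^e*a^[n∸e]≡a^n : a ^ e * a ^ (n ∸ e) ≡ a ^ n
  a^e*a^[n∸e]≡a^n = trans (sym (^-distribˡ-+-* a e (n ∸ e))) (cong (a ^_) (m+[n∸m]≡n e≤n))

prime^∣m*n⇒∣n : ∀ {q m} e n → Prime q → ¬ q ∣ m → q ^ e ∣ m * n → q ^ e ∣ n
prime^∣m*n⇒∣n zero n _ _ _ = 1∣ n
prime^∣m*n⇒∣n {q} {m} (suc e) n q-prime q∤m q^1+e∣m*n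
  with euclidsLemma m n q-prime (m*n∣⇒m∣ q (q ^ e) q^1+e∣m*n)
... | inj₁ q∣m = ⊥-elim (q∤m q∣m)
... | inj₂ (divides k refl) = subst (q ^ suc e ∣_) (*-comm q k) (*-monoʳ-∣ q q^e∣k)
  where
  instance _ = prime⇒nonZero q-prime
  m*[k*q]≡q*[m*k] : m * (k * q) ≡ q * (m * k)
  m*[k*q]≡q*[m*k] = trans (sym (*-assoc m k q)) (*-comm (m * k) q)
  q^e∣k : q ^ e ∣ k
  q^e∣k = prime^∣m*n⇒∣n e k q-prime q∤m (*-cancelˡ-∣ q (subst (q * q ^ e ∣_) m*[k*q]≡q*[m*k] q^1+e∣m*n))

idempotent∧∤⇒≡1 : ∀ {q e} (x : ℕ) → Prime q → ¬ q ∣ x → (x * x) ≡ x [mod q ^ e ] → x ≡ 1 [mod q ^ e ]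
idempotent∧∤⇒≡1 {q} {e} x q-prime q∤x x²≡x =
  prime^∣m*n⇒∣n e (∣ x - 1 ∣) q-prime q∤x (subst (q ^ e ∣_) ∣x²-x∣≡x*∣x-1∣ x²≡x)
  where
  ∣x²-x∣≡x*∣x-1∣ : ∣ x * x - x ∣ ≡ x * ∣ x - 1 ∣
  ∣x²-x∣≡x*∣x-1∣ = trans (cong (λ y → ∣ x * x - y ∣) (sym (*-identityʳ x))) (sym (*-distribˡ-∣-∣ x x 1))

n<m^n : ∀ {m} → 1 < m → ∀ n → n < m ^ n
n<m^n 1<m zero = s≤s z≤n
n<m^n {m@(suc _)} 1<m (suc n) = begin-strict
  suc n     ≤⟨ n<m^n 1<m n ⟩
  m ^ n     <⟨ m<m*n (m ^ n) m {{m^n≢0 m n}} 1<m ⟩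
  m ^ n * m ≡⟨ *-comm (m ^ n) m ⟩
  m ^ suc n ∎
  where open ≤-Reasoning

≡[mod]-sym : ∀ {m} x y → x ≡ y [mod m ] → y ≡ x [mod m ]
≡[mod]-sym {m} x y = subst (m ∣_) (∣-∣-comm x y)

≡[mod]⇒∣⇔∣ : ∀ {m} x y → x ≡ y [mod m ] → m ∣ x ⇔ m ∣ y
≡[mod]⇒∣⇔∣ {m} x y x≡y = mk⇔ (∣-resp x y x≡y) (∣-resp y x (≡[mod]-sym x y x≡y))
  where
  ∣-resp : ∀ x y → x ≡ y [mod m ] → m ∣ x → m ∣ y
  ∣-resp x y x≡y m∣x with ≤-total x y
  ... | inj₁ x≤y = ∣m∸n∣n⇒∣m m x≤y (subst (m ∣_) (m≤n⇒∣m-n∣≡n∸m x≤y) x≡y) m∣x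
  ... | inj₂ y≤x = ∣m+n∣m⇒∣n (subst (m ∣_) (sym (m∸n+n≡m y≤x)) m∣x) (subst (m ∣_) (m≤n⇒∣n-m∣≡n∸m y≤x) x≡y)

module _ {m : ℕ} .{{_ : NonZero m}} where

  %≡⇒≡[mod] : ∀ x y → x % m ≡ y % m → x ≡ y [mod m ]
  %≡⇒≡[mod] x y x%m≡y%m = subst (m ∣_) (sym ∣x-y∣≡∣x/m-y/m∣*m) (n∣m*n ∣ x / m - y / m ∣)
    where
    open ≡-Reasoning
    ∣x-y∣≡∣x/m-y/m∣*m : ∣ x - y ∣ ≡ ∣ x / m - y / m ∣ * m
    ∣x-y∣≡∣x/m-y/m∣*m = begin
      ∣ x - y ∣                                 ≡⟨ cong₂ ∣_-_∣ (m≡m%n+[m/n]*n x m) (m≡m%n+[m/n]*n y m) ⟩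
      ∣ x % m + x / m * m - y % m + y / m * m ∣ ≡⟨ cong (λ z → ∣ x % m + x / m * m - z + y / m * m ∣) x%m≡y%m ⟨
      ∣ x % m + x / m * m - x % m + y / m * m ∣ ≡⟨ ∣m+n-m+o∣≡∣n-o∣ (x % m) (x / m * m) (y / m * m) ⟩
      ∣ x / m * m - y / m * m ∣                 ≡⟨ *-distribʳ-∣-∣ m (x / m) (y / m) ⟨
      ∣ x / m - y / m ∣ * m                     ∎

  ≤∧∣∸⇒%≡ : ∀ {x y} → x ≤ y → m ∣ y ∸ x → x % m ≡ y % m
  ≤∧∣∸⇒%≡ {x} x≤y m∣y∸x = trans (sym (%-remove-+ʳ x m∣y∸x)) (cong (_% m) (m+[n∸m]≡n x≤y))

  ≡[mod]⇒%≡ : ∀ x y → x ≡ y [mod m ] → x % m ≡ y % m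
  ≡[mod]⇒%≡ x y x≡y with ≤-total x y
  ... | inj₁ x≤y = ≤∧∣∸⇒%≡ x≤y (subst (m ∣_) (m≤n⇒∣m-n∣≡n∸m x≤y) x≡y)
  ... | inj₂ y≤x = sym (≤∧∣∸⇒%≡ y≤x (subst (m ∣_) (m≤n⇒∣n-m∣≡n∸m y≤x) x≡y))

  ≡[mod]-trans : ∀ x y z → x ≡ y [mod m ] → y ≡ z [mod m ] → x ≡ z [mod m ]
  ≡[mod]-trans x y z x≡y y≡z = %≡⇒≡[mod] x z (trans (≡[mod]⇒%≡ x y x≡y) (≡[mod]⇒%≡ y z y≡z))

  ∣∧∣⇒≡[mod] : ∀ {x y} → m ∣ x → m ∣ y → x ≡ y [mod m ]
  ∣∧∣⇒≡[mod] {x} {y} m∣x m∣y = %≡⇒≡[mod] x y (trans (n∣m⇒m%n≡0 x m m∣x) (sym (n∣m⇒m%n≡0 y m m∣y)))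

  toℕ-mod-≡[mod] : ∀ x → toℕ (x mod m) ≡ x [mod m ]
  toℕ-mod-≡[mod] x = %≡⇒≡[mod] (toℕ (x mod m)) x (trans (cong (_% m) (toℕ-fromℕ< _)) (m%n%n≡m%n x m))

  ≡[mod]⇒≡mod : ∀ (v : Fin m) x → toℕ v ≡ x [mod m ] → v ≡ x mod m
  ≡[mod]⇒≡mod v x v≡x = toℕ-injective (begin
    toℕ v           ≡⟨ m<n⇒m%n≡m (toℕ<n v) ⟨
    toℕ v % m       ≡⟨ ≡[mod]⇒%≡ (toℕ v) x v≡x ⟩
    x % m           ≡⟨ toℕ-fromℕ< _ ⟨
    toℕ (x mod m)   ∎)
    where open ≡-Reasoning

∏-∣ : ∀ {r} (f : Fin r → ℕ) i → f i ∣ ∏ f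
∏-∣ f Fin.zero    = m∣m*n _
∏-∣ f (Fin.suc i) = ∣n⇒∣m*n (f Fin.zero) (∏-∣ (f ∘ Fin.suc) i)

∏-nonZero : ∀ {r} (f : Fin r → ℕ) → (∀ i → NonZero (f i)) → NonZero (∏ f)
∏-nonZero {zero}  f f≢0 = _
∏-nonZero {suc r} f f≢0 =
  m*n≢0 (f Fin.zero) (∏ (f ∘ Fin.suc)) {{f≢0 Fin.zero}} {{∏-nonZero (f ∘ Fin.suc) (f≢0 ∘ Fin.suc)}}

∏∈-∣ : ∀ {r} (J : Subset r) (f : Fin r → ℕ) {j} → j ∈ J → f j ∣ ∏∈ J f
∏∈-∣ (true  ∷ J) f here        = m∣m*n _
∏∈-∣ (true  ∷ J) f (there j∈J) = ∣n⇒∣m*n (f Fin.zero) (∏∈-∣ J (f ∘ Fin.suc) j∈J)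
∏∈-∣ (false ∷ J) f (there j∈J) = ∏∈-∣ J (f ∘ Fin.suc) j∈J

prime∣∏∈⇒≡ : ∀ {r q} (J : Subset r) (f : Fin r → ℕ) → Prime q → (∀ i → Prime (f i)) →
             q ∣ ∏∈ J f → ∃ λ i → i ∈ J × q ≡ f i
prime∣∏∈⇒≡ [] f q-prime f-prime q∣1 = ⊥-elim (prime∤1 q-prime q∣1)
prime∣∏∈⇒≡ (true ∷ J) f q-prime f-prime q∣∏ with euclidsLemma (f Fin.zero) (∏∈ J (f ∘ Fin.suc)) q-prime q∣∏
... | inj₁ q∣f₀ = Fin.zero , here , prime∣prime⇒≡ q-prime (f-prime Fin.zero) q∣f₀
... | inj₂ q∣∏′ with prime∣∏∈⇒≡ J (f ∘ Fin.suc) q-prime (f-prime ∘ Fin.suc) q∣∏′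
...   | i , i∈J , q≡fi = Fin.suc i , there i∈J , q≡fi
prime∣∏∈⇒≡ (false ∷ J) f q-prime f-prime q∣∏ with prime∣∏∈⇒≡ J (f ∘ Fin.suc) q-prime (f-prime ∘ Fin.suc) q∣∏
... | i , i∈J , q≡fi = Fin.suc i , there i∈J , q≡fi

prime∣∏^⇒≡ : ∀ {r q} (f g : Fin r → ℕ) → Prime q → (∀ i → Prime (f i)) →
             q ∣ ∏ (λ i → f i ^ g i) → ∃ λ i → q ≡ f i
prime∣∏^⇒≡ {zero} f g q-prime f-prime q∣1 = ⊥-elim (prime∤1 q-prime q∣1)
prime∣∏^⇒≡ {suc r} f g q-prime f-prime q∣∏
  with euclidsLemma (f Fin.zero ^ g Fin.zero) (∏ (λ i → f (Fin.suc i) ^ g (Fin.suc i))) q-prime q∣∏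
... | inj₁ q∣f₀^g₀ = Fin.zero , prime∣prime⇒≡ q-prime (f-prime Fin.zero) (prime∣^⇒∣ (g Fin.zero) q-prime q∣f₀^g₀)
... | inj₂ q∣∏′ with prime∣∏^⇒≡ (f ∘ Fin.suc) (g ∘ Fin.suc) q-prime (f-prime ∘ Fin.suc) q∣∏′
...   | i , q≡fi = Fin.suc i , q≡fi

prime-powers∣⇒modulus∣ : ∀ {r} (p e : Fin r → ℕ) → (∀ i → Prime (p i)) → Injective _≡_ _≡_ p →
                         ∀ x → (∀ j → p j ^ e j ∣ x) → modulus p e ∣ x
prime-powers∣⇒modulus∣ {zero} p e p-prime p-injective x _ = 1∣ x
prime-powers∣⇒modulus∣ {suc r} p e p-prime p-injective x p^e∣x
  with prime-powers∣⇒modulus∣ (p ∘ Fin.suc) (e ∘ Fin.suc) (p-prime ∘ Fin.suc)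
         (suc-injective ∘ p-injective) x (p^e∣x ∘ Fin.suc)
... | divides k refl = *-monoˡ-∣ Q (prime^∣m*n⇒∣n (e Fin.zero) k (p-prime Fin.zero) p₀∤Q
                                      (subst (p Fin.zero ^ e Fin.zero ∣_) (*-comm k Q) (p^e∣x Fin.zero)))
  where
  Q : ℕ
  Q = modulus (p ∘ Fin.suc) (e ∘ Fin.suc)
  p₀∤Q : ¬ p Fin.zero ∣ Q
  p₀∤Q p₀∣Q with prime∣∏^⇒≡ (p ∘ Fin.suc) (e ∘ Fin.suc) (p-prime Fin.zero) (p-prime ∘ Fin.suc) p₀∣Q
  ... | i , p₀≡pᵢ with p-injective p₀≡pᵢ
  ... | ()

module _ {m : ℕ} .{{_ : NonZero m}} (a : ℕ) where

  ^-%-collision : ∃₂ λ s P → NonZero P × a ^ s % m ≡ a ^ (P + s) % m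
  ^-%-collision with pigeonhole (n<1+n m) (λ k → a ^ toℕ k mod m)
  ... | i , j , i<j , aⁱ≡aʲ = toℕ i , toℕ j ∸ toℕ i , >-nonZero (m<n⇒0<n∸m i<j) , (begin
    a ^ toℕ i % m                        ≡⟨ toℕ-fromℕ< _ ⟨
    toℕ (a ^ toℕ i mod m)                ≡⟨ cong toℕ aⁱ≡aʲ ⟩
    toℕ (a ^ toℕ j mod m)                ≡⟨ toℕ-fromℕ< _ ⟩
    a ^ toℕ j % m                        ≡⟨ cong (λ k → a ^ k % m) (m∸n+n≡m (<⇒≤ i<j)) ⟨
    a ^ (toℕ j ∸ toℕ i + toℕ i) % m      ∎)
    where open ≡-Reasoning

  ^-%-shift : ∀ {s t} → a ^ s % m ≡ a ^ t % m → ∀ k → a ^ (k + s) % m ≡ a ^ (k + t) % m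
  ^-%-shift {s} {t} aˢ≡aᵗ k = begin
    a ^ (k + s) % m                 ≡⟨ cong (_% m) (^-distribˡ-+-* a k s) ⟩
    a ^ k * a ^ s % m               ≡⟨ %-distribˡ-* (a ^ k) (a ^ s) m ⟩
    (a ^ k % m) * (a ^ s % m) % m   ≡⟨ cong (λ z → (a ^ k % m) * z % m) aˢ≡aᵗ ⟩
    (a ^ k % m) * (a ^ t % m) % m   ≡⟨ %-distribˡ-* (a ^ k) (a ^ t) m ⟨
    a ^ k * a ^ t % m               ≡⟨ cong (_% m) (^-distribˡ-+-* a k t) ⟨
    a ^ (k + t) % m                 ∎
    where open ≡-Reasoning

  ^-%-periodic : ∀ {s P} → a ^ s % m ≡ a ^ (P + s) % m → ∀ n → a ^ s % m ≡ a ^ (n * P + s) % m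
  ^-%-periodic aˢ≡aᴾ⁺ˢ zero = refl
  ^-%-periodic {s} {P} aˢ≡aᴾ⁺ˢ (suc n) = begin
    a ^ s % m                   ≡⟨ ^-%-periodic aˢ≡aᴾ⁺ˢ n ⟩
    a ^ (n * P + s) % m         ≡⟨ ^-%-shift aˢ≡aᴾ⁺ˢ (n * P) ⟩
    a ^ (n * P + (P + s)) % m   ≡⟨ cong (λ k → a ^ k % m) (+-assoc (n * P) P s) ⟨
    a ^ (n * P + P + s) % m     ≡⟨ cong (λ k → a ^ (k + s) % m) (+-comm (n * P) P) ⟩
    a ^ (P + n * P + s) % m     ∎
    where open ≡-Reasoning

  ^-%-idempotent : ∀ b → ∃ λ N → b ≤ N × a ^ N % m ≡ a ^ (N + N) % m
  ^-%-idempotent b with ^-%-collision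
  ... | s , P , P≢0 , aˢ≡aᴾ⁺ˢ = N , ≤-trans (m≤n+m b s) s+b≤N , (begin
    a ^ N % m                   ≡⟨ cong (λ k → a ^ k % m) (m∸n+n≡m s≤N) ⟨
    a ^ (N ∸ s + s) % m         ≡⟨ ^-%-shift (^-%-periodic aˢ≡aᴾ⁺ˢ (s + b)) (N ∸ s) ⟩
    a ^ (N ∸ s + (N + s)) % m   ≡⟨ cong (λ k → a ^ k % m) (N∸s+[N+s]≡N+N) ⟩
    a ^ (N + N) % m             ∎)
    where
    open ≡-Reasoning
    N : ℕ
    N = (s + b) * P
    s+b≤N : s + b ≤ N
    s+b≤N = m≤m*n (s + b) P {{P≢0}}
    s≤N : s ≤ N
    s≤N = ≤-trans (m≤m+n s b) s+b≤N
    N∸s+[N+s]≡N+N : N ∸ s + (N + s) ≡ N + N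
    N∸s+[N+s]≡N+N = trans (cong (N ∸ s +_) (+-comm N s))
                          (trans (sym (+-assoc (N ∸ s) s N)) (cong (_+ N) (m∸n+n≡m s≤N)))

spEdge-resp-∣ : ∀ {m q} → Prime q → q ∣ m → ∀ {b c} → SPEdge m b c → q ∣ toℕ b ⇔ q ∣ toℕ c
spEdge-resp-∣ {m} {q} q-prime q∣m {b} {c} (a , suc i , _ , b≡aⁱ , c≡aⁱ⁺¹) =
  ⇔-trans (≡[mod]⇒∣⇔∣ (toℕ b) (a ^ suc i) (∣-trans q∣m b≡aⁱ))
  (⇔-trans (prime∣^suc⇔∣ {a = a} i q-prime)
  (⇔-trans (⇔-sym (prime∣^suc⇔∣ {a = a} (suc i) q-prime))
           (⇔-sym (≡[mod]⇒∣⇔∣ (toℕ c) (a ^ suc (suc i)) (∣-trans q∣m c≡aⁱ⁺¹)))))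

sameComponent-resp-∣ : ∀ {m q} → Prime q → q ∣ m → ∀ {b c} → SameComponent m b c → q ∣ toℕ b ⇔ q ∣ toℕ c
sameComponent-resp-∣ {m} {q} q-prime q∣m = gfold ⇔-isEquivalence (λ b → q ∣ toℕ b) (spEdge-resp-∣ q-prime q∣m)

^-sameComponent : ∀ {m} .{{_ : NonZero m}} a {k} → 1 ≤ k → SameComponent m (a mod m) (a ^ k mod m)
^-sameComponent {m} a {suc zero}    _ = subst (λ x → SameComponent m (a mod m) (x mod m)) (sym (*-identityʳ a)) ε
^-sameComponent {m} a {suc (suc k)} _ = ^-sameComponent a {suc k} (s≤s z≤n) ◅◅ return aᵏ⁺¹→aᵏ⁺²
  where
  aᵏ⁺¹→aᵏ⁺² : SPEdge m (a ^ suc k mod m) (a ^ suc (suc k) mod m)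
  aᵏ⁺¹→aᵏ⁺² = a , suc k , s≤s z≤n , toℕ-mod-≡[mod] (a ^ suc k) , toℕ-mod-≡[mod] (a ^ suc (suc k))

module PrimePowerFactorisation {r} (p e : Fin r → ℕ) (p-prime : ∀ i → Prime (p i))
                               (p-injective : Injective _≡_ _≡_ p) (e≥1 : ∀ i → 1 ≤ e i) where

  m : ℕ
  m = modulus p e

  instance
    p^e-nonZero : ∀ {j} → NonZero (p j ^ e j)
    p^e-nonZero {j} = m^n≢0 (p j) (e j) {{prime⇒nonZero (p-prime j)}}

    m-nonZero : NonZero m
    m-nonZero = ∏-nonZero (λ i → p i ^ e i) (λ _ → p^e-nonZero)

  p^e∣m : ∀ j → p j ^ e j ∣ m
  p^e∣m = ∏-∣ (λ i → p i ^ e i)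

  p∣p^e : ∀ j → p j ∣ p j ^ e j
  p∣p^e j with e j | e≥1 j
  ... | suc k | _ = m∣m*n (p j ^ k)

  p∣m : ∀ j → p j ∣ m
  p∣m j = ∣-trans (p∣p^e j) (p^e∣m j)

  e≤m : ∀ j → e j ≤ m
  e≤m j = ≤-trans (<⇒≤ (n<m^n (prime>1 (p-prime j)) (e j))) (∣⇒≤ (p^e∣m j))

  p∣multiplier⇔∈ : ∀ J j → p j ∣ multiplier p J ⇔ j ∈ J
  p∣multiplier⇔∈ J j = mk⇔ ∈J (∏∈-∣ J p)
    where
    ∈J : p j ∣ multiplier p J → j ∈ J
    ∈J pⱼ∣πJ with prime∣∏∈⇒≡ J p (p-prime j) p-prime pⱼ∣πJ
    ... | i , i∈J , pⱼ≡pᵢ with p-injective pⱼ≡pᵢ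
    ... | refl = i∈J

  module _ (I : Subset r) (d : Fin m) (d-idem : IsIdempotentFor p e I (toℕ d)) where

    π : ℕ
    π = multiplier p I

    p^e∣d : ∀ {j} → j ∈ I → p j ^ e j ∣ toℕ d
    p^e∣d {j} j∈I = subst (p j ^ e j ∣_) (∣-∣-identityʳ (toℕ d)) (proj₁ d-idem j j∈I)

    p∣d⇔∈ : ∀ j → p j ∣ toℕ d ⇔ j ∈ I
    p∣d⇔∈ j = mk⇔ ∈I (λ j∈I → ∣-trans (p∣p^e j) (p^e∣d j∈I))
      where
      ∈I : p j ∣ toℕ d → j ∈ I
      ∈I pⱼ∣d with j ∈? I
      ... | yes j∈I = j∈I
      ... | no  j∉I = ⊥-elim (prime∤1 (p-prime j)
                        (Equivalence.to (≡[mod]⇒∣⇔∣ (toℕ d) 1 (∣-trans (p∣p^e j) (proj₂ d-idem j j∉I))) pⱼ∣d))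

    power≡idempotent : ∀ {N} → m ≤ N → π ^ N % m ≡ π ^ (N + N) % m → (π ^ N) ≡ toℕ d [mod m ]
    power≡idempotent {N} m≤N πᴺ≡π²ᴺ = prime-powers∣⇒modulus∣ p e p-prime p-injective _ πᴺ≡d
      where
      πᴺ≡d : ∀ j → (π ^ N) ≡ toℕ d [mod p j ^ e j ]
      πᴺ≡d j with j ∈? I
      ... | yes j∈I = ∣∧∣⇒≡[mod] (∣∧≤⇒^∣^ (∏∈-∣ I p j∈I) (≤-trans (e≤m j) m≤N)) (p^e∣d j∈I)
      ... | no  j∉I = ≡[mod]-trans (π ^ N) 1 (toℕ d) (idempotent∧∤⇒≡1 {e = e j} (π ^ N) (p-prime j) pⱼ∤πᴺ πᴺπᴺ≡πᴺ)
                                   (≡[mod]-sym (toℕ d) 1 (proj₂ d-idem j j∉I))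
        where
        pⱼ∤πᴺ : ¬ p j ∣ π ^ N
        pⱼ∤πᴺ = j∉I ∘ Equivalence.to (p∣multiplier⇔∈ I j) ∘ prime∣^⇒∣ N (p-prime j)
        πᴺπᴺ≡πᴺ : (π ^ N * π ^ N) ≡ (π ^ N) [mod p j ^ e j ]
        πᴺπᴺ≡πᴺ = ∣-trans (p^e∣m j) (subst (λ y → y ≡ (π ^ N) [mod m ]) (^-distribˡ-+-* π N N)
                                              (%≡⇒≡[mod] (π ^ (N + N)) (π ^ N) (sym πᴺ≡π²ᴺ)))

    multiplier∈component : SameComponent m d (π mod m)
    multiplier∈component = via-idempotent-power (^-%-idempotent π m)
      where
      -- A helper instead of `with`: abstracting the witness makes Agda unfold the pigeonhole search.
      via-idempotent-power : (∃ λ N → m ≤ N × π ^ N % m ≡ π ^ (N + N) % m) → SameComponent m d (π mod m)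
      via-idempotent-power (N , m≤N , πᴺ≡π²ᴺ) =
        subst (λ v → SameComponent m v (π mod m))
              (sym (≡[mod]⇒≡mod d (π ^ N) (≡[mod]-sym (π ^ N) (toℕ d) (power≡idempotent m≤N πᴺ≡π²ᴺ))))
              (symmetric _ (^-sameComponent π (≤-trans (>-nonZero⁻¹ m) m≤N)))

    multiplier∉component : ∀ J → J ≢ I → ∀ v → toℕ v ≡ multiplier p J [mod m ] → ¬ SameComponent m d v
    multiplier∉component J J≢I v v≡πJ d~v = J≢I (⊆-antisym (λ {j} → Equivalence.to (J⇔I j))
                                                           (λ {j} → Equivalence.from (J⇔I j)))
      where
      J⇔I : ∀ j → j ∈ J ⇔ j ∈ I
      J⇔I j = ⇔-trans (⇔-sym (p∣multiplier⇔∈ J j))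
             (⇔-trans (⇔-sym (≡[mod]⇒∣⇔∣ (toℕ v) (multiplier p J) (∣-trans (p∣m j) v≡πJ)))
             (⇔-trans (⇔-sym (sameComponent-resp-∣ (p-prime j) (p∣m j) d~v))
                      (p∣d⇔∈ j)))

mainTheorem4 : (r : ℕ) (p e : Fin r → ℕ) →
    (∀ i → Prime (p i)) → Injective _≡_ _≡_ p → (∀ i → 1 ≤ e i) →
    (I : Subset r) (d : Fin (modulus p e)) → IsIdempotentFor p e I (toℕ d) →
    (∃ λ (v : Fin (modulus p e)) →
        (toℕ v ≡ multiplier p I [mod modulus p e ]) × SameComponent (modulus p e) d v)
    × (∀ (J : Subset r) → J ≢ I → ∀ (v : Fin (modulus p e)) →
        toℕ v ≡ multiplier p J [mod modulus p e ] → ¬ SameComponent (modulus p e) d v)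
mainTheorem4 r p e p-prime p-injective e≥1 I d d-idem =
    (multiplier p I mod m , toℕ-mod-≡[mod] (multiplier p I) , multiplier∈component I d d-idem)
  , multiplier∉component I d d-idem
  where open PrimePowerFactorisation p e p-prime p-injective e≥1
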